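{- Let $\beta,\gamma>0$ and let $G(V,E)$ be a $D$-regular graph on $n$ nodes with $D\geq\beta n$ and $\phi(G)\geq\gamma D$. Let $(S,\bar S)$ be a bisection of $V$ and set $\mu=\frac{\beta\gamma^2}{4}$. Define sets $S_0,S_1,\dots$ by the following process: set $S_0\leftarrow\bar S$ and $T\leftarrow S$; for $i=1,2,\dots$, while $T\neq\emptyset$, let $S_i\subseteq T$ be the set of nodes of $T$ having at least $\mu D$ neighbors in $S_{i-1}$, and set $T\leftarrow T\setminus S_i$. Then the process terminates (i.e., reaches $T=\emptyset$) after $t\leq\frac{2}{\beta\gamma}$ iterations.
   Context: Graphs are undirected and unweighted. The edge-expansion of a graph $G(V,E)$ is $\phi(G)=\min\{|E(S,\bar S)|/|S| : S\subset V,\ 0<|S|\leq|V|/2\}$, where $E(S,\bar S)$ is the set of edges with exactly one endpoint in $S$. A bisection of $V$ with $|V|=n$ is a partition $(S,\bar S)$ with parts of sizes $n/2$ each if $n$ is even, or $\lfloor n/2\rfloor$ and $\lceil n/2\rceil$ if $n$ is odd. -}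

module Defs where

open import Data.Bool using (Bool; true; false; _∧_; not)
open import Data.Nat using (ℕ; zero; suc; _+_)
open import Data.Fin using (Fin)
open import Data.Vec using (Vec; tabulate; lookup)
open import Data.Fin.Subset using (Subset; _∈_; _∉_; ∣_∣; _∩_; _─_)
open import Data.Product using (_×_; _,_; proj₁; proj₂)
open import Relation.Binary.PropositionalEquality using (_≡_)
open import Data.Rational using (ℚ; _≤ᵇ_; _*_)
open import Data.Integer using (+_)
import Data.Rational as Q

record Graph (n : ℕ) : Set where
  field
    adj   : Fin n → Fin n → Bool
    sym   : ∀ u v → adj u v ≡ adj v u
    irrefl : ∀ v → adj v v ≡ false
open Graph public

sumFin : ∀ {n} → (Fin n → ℕ) → ℕ
sumFin {zero}  f = 0
sumFin {suc n} f = f Fin.zero + sumFin (λ i → f (Fin.suc i))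
  where import Data.Fin as Fin

nbhd : ∀ {n} → Graph n → Fin n → Subset n
nbhd G v = tabulate (adj G v)

degIn : ∀ {n} → Graph n → Subset n → Fin n → ℕ
degIn G A v = ∣ nbhd G v ∩ A ∣

deg : ∀ {n} → Graph n → Fin n → ℕ
deg G v = ∣ nbhd G v ∣

Regular : ∀ {n} → Graph n → ℕ → Set
Regular G D = ∀ v → deg G v ≡ D

compl : ∀ {n} → Subset n → Subset n
compl A = Data.Vec.map not A

-- |E(S, S̄)|: number of edges with exactly one endpoint in S
-- (each such edge is counted once, from its endpoint in S).
cut : ∀ {n} → Graph n → Subset n → ℕ
cut G S = sumFin (λ v → if lookup S v then degIn G (compl S) v else 0)
  where open import Data.Bool using (if_then_else_)

ℕtoℚ : ℕ → ℚ
ℕtoℚ k = (+ k) Q./ 1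

-- φ(G) ≥ c, i.e. |E(S,S̄)|/|S| ≥ c for every S with 0 < |S| ≤ n/2
-- (phrased as |E(S,S̄)| ≥ c·|S|, equivalent since |S| > 0).
ExpansionAtLeast : ∀ {n} → Graph n → ℚ → Set
ExpansionAtLeast {n} G c =
  ∀ (S : Subset n) → 0 Data.Nat.< ∣ S ∣ → 2 Data.Nat.* ∣ S ∣ Data.Nat.≤ n →
  c * ℕtoℚ ∣ S ∣ Data.Rational.≤ ℕtoℚ (cut G S)

Bisection : ∀ {n} → Subset n → Set
Bisection {n} S = ∣ S ∣ ≡ n Data.Nat./ 2 ⊎ ∣ S ∣ ≡ n Data.Nat.∸ (n Data.Nat./ 2)
  where open import Data.Sum using (_⊎_)

-- The peeling process. State after i iterations: (S_i , T).
-- Initially (S_0 , T) = (S̄ , S). One step: S_{i+1} = { v ∈ T : deg into S_i ≥ θ },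
-- T ← T ∖ S_{i+1}. Here θ is the threshold μD.
step : ∀ {n} → Graph n → ℚ → Subset n × Subset n → Subset n × Subset n
step G θ (prev , T) = (Si , T ─ Si)
  where
    Si = T ∩ tabulate (λ v → θ ≤ᵇ ℕtoℚ (degIn G prev v))

proc : ∀ {n} → Graph n → ℚ → Subset n → ℕ → Subset n × Subset n
proc G θ S zero    = (compl S , S)
proc G θ S (suc i) = step G θ (proc G θ S i)

Tafter : ∀ {n} → Graph n → ℚ → Subset n → ℕ → Subset n
Tafter G θ S i = proj₂ (proc G θ S i)

-- Write β = p₁/q₁, γ = p₂/q₂, θ = βγ²D/4 and pick t with 1 ≤ s := tβγ ≤ 2. Suppose a vertex v
-- survives t rounds. A vertex still in T after round k was never selected, so it has fewer than
-- (k+1)θ ≤ tθ neighbours outside T_k. Hence γD|T_k| ≤ |E(T_k, T̄_k)| ≤ D|S_{k+1}| + tθ|T_k|, i.e.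
-- |S_{k+1}| ≥ γ(1 - s/4)|T_k|, while counting the neighbours of v gives |T_k| > D - tθ ≥ D(1 - s/4)
-- (γ ≤ 1 by expansion of a single vertex). Summing over the t rounds,
-- n/2 > Σ_k |S_{k+1}| ≥ tγ(1 - s/4)²D ≥ s(1 - s/4)²n, i.e. s(4 - s)² < 8, which fails on [1, 2].
-- A bisection may have |S| = (n + 1)/2; expansion is then applied to the complement, losing one
-- vertex in the first round only.

module Submission where

open import Defs hiding (sym)
open import Data.Bool using (Bool; true; false; _∧_; not; if_then_else_; T)
open import Data.Bool.Properties using (∧-zeroʳ; ∧-identityʳ)
open import Data.Fin using (Fin) renaming (zero to fzero; suc to fsuc)
open import Data.Fin.Subset using (Subset; ∣_∣; _∩_; _─_; ⊥; ⁅_⁆)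
open import Data.Fin.Subset.Properties using (∣p∣≤∣x∷p∣; ∣⁅x⁆∣≡1; nonempty?; Empty-unique)
import Data.Integer as ℤ
import Data.Integer.Properties as ℤ
open import Data.Nat
open import Data.Nat.Coprimality using (Coprime)
open import Data.Nat.DivMod using (m/n*n≤m; m≡m%n+[m/n]*n; m%n<n)
open import Data.Nat.Properties
open import Algebra.Properties.CommutativeSemigroup +-commutativeSemigroup using () renaming (interchange to +-interchange)
open import Data.Nat.Tactic.RingSolver using (solve-∀)
open import Data.Product using (∃; _×_; _,_; proj₁; proj₂)
open import Data.Rational as ℚ using (ℚ; mkℚ)
import Data.Rational.Properties as ℚ
open import Data.Rational.Unnormalised as ℚᵘ using (mkℚᵘ; *≡*; *≤*)
import Data.Rational.Unnormalised.Properties as ℚᵘ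
open import Data.Sum using (inj₁; inj₂)
open import Data.Vec using ([]; _∷_; lookup)
open import Data.Vec.Properties using (lookup-zipWith; lookup∘tabulate; lookup-map; []=⇒lookup)
open import Function using (_∘_; flip)
open import Relation.Binary.PropositionalEquality
open import Relation.Nullary using (contradiction; yes; no; ¬_)

-- x ≈ a /1+ b  says that x = a / (1 + b), the form in which mkℚ stores a positive rational.
infix 4 _≈_/1+_
record _≈_/1+_ (x : ℚ) (a b : ℕ) : Set where
  constructor fraction
  field toℚᵘ-≃ : ℚ.toℚᵘ x ℚᵘ.≃ mkℚᵘ (ℤ.+ a) b

ℕtoℚ≈ : ∀ k → ℕtoℚ k ≈ k /1+ 0
ℕtoℚ≈ k = fraction (ℚ.toℚᵘ-fromℚᵘ (mkℚᵘ (ℤ.+ k) 0))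

1/4≈ : (ℤ.+ 1) ℚ./ 4 ≈ 1 /1+ 3
1/4≈ = fraction (ℚ.toℚᵘ-fromℚᵘ (mkℚᵘ (ℤ.+ 1) 3))

mkℚ≈ : ∀ a d .(c : Coprime a (suc d)) → mkℚ (ℤ.+ a) d c ≈ a /1+ d
mkℚ≈ a d c = fraction ℚᵘ.≃-refl

*-≈ : ∀ {x y a b c d} → x ≈ a /1+ b → y ≈ c /1+ d → x ℚ.* y ≈ a * c /1+ (d + b * suc d)
*-≈ {x} {y} {a} {b} {c} {d} (fraction x≃) (fraction y≃) = fraction
  (ℚᵘ.≃-trans (ℚ.toℚᵘ-homo-* x y) (ℚᵘ.≃-trans (ℚᵘ.*-cong x≃ y≃)
    (*≡* (cong (ℤ._* (ℤ.+ suc (d + b * suc d))) (sym (ℤ.pos-* a c))))))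

≤⇒cross-≤ : ∀ {x y a b c d} → x ≈ a /1+ b → y ≈ c /1+ d → x ℚ.≤ y → a * suc d ≤ c * suc b
≤⇒cross-≤ {x} {y} {a} {b} {c} {d} (fraction x≃) (fraction y≃) x≤y
  with ℚᵘ.≤-respʳ-≃ y≃ (ℚᵘ.≤-respˡ-≃ x≃ (ℚ.toℚᵘ-mono-≤ x≤y))
... | *≤* ad≤cb = ℤ.drop‿+≤+ (subst₂ ℤ._≤_ (sym (ℤ.pos-* a (suc d))) (sym (ℤ.pos-* c (suc b))) ad≤cb)

cross-≤⇒≤ : ∀ {x y a b c d} → x ≈ a /1+ b → y ≈ c /1+ d → a * suc d ≤ c * suc b → x ℚ.≤ y
cross-≤⇒≤ {x} {y} {a} {b} {c} {d} (fraction x≃) (fraction y≃) ad≤cb =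
  ℚ.toℚᵘ-cancel-≤ (ℚᵘ.≤-respʳ-≃ (ℚᵘ.≃-sym y≃) (ℚᵘ.≤-respˡ-≃ (ℚᵘ.≃-sym x≃)
    (*≤* (subst₂ ℤ._≤_ (ℤ.pos-* a (suc d)) (ℤ.pos-* c (suc b)) (ℤ.+≤+ ad≤cb)))))

positive⇒≈ : ∀ x → ℚ.Positive x → ∃ λ a → ∃ λ b → x ≈ suc a /1+ b
positive⇒≈ (mkℚ ℤ.+[1+ a ] b coprime) _ = a , b , mkℚ≈ (suc a) b coprime

≤ᵇ≡false⇒cross-< : ∀ {x a b} d → x ≈ a /1+ b → (x ℚ.≤ᵇ ℕtoℚ d) ≡ false → suc b * d < a
≤ᵇ≡false⇒cross-< {x} {a} {b} d x≈ x≰ᵇd = ≰⇒> λ a≤ → subst T x≰ᵇd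
  (ℚ.≤⇒≤ᵇ (cross-≤⇒≤ x≈ (ℕtoℚ≈ d) (subst₂ _≤_ (sym (*-identityʳ a)) (*-comm (suc b) d) a≤)))

*ℕ≤ℕ⇒cross-≤ : ∀ {x a b} m k → x ≈ a /1+ b → x ℚ.* ℕtoℚ m ℚ.≤ ℕtoℚ k → a * m ≤ suc b * k
*ℕ≤ℕ⇒cross-≤ {x} {a} {b} m k x≈ xm≤k =
  subst₂ _≤_ (*-identityʳ (a * m)) (trans (cong (λ c → k * suc c) (*-identityʳ b)) (*-comm k (suc b)))
  (≤⇒cross-≤ (*-≈ x≈ (ℕtoℚ≈ m)) (ℕtoℚ≈ k) xm≤k)

cross-≤⇒ℕ*≤ℕ : ∀ {x a b} t k → x ≈ a /1+ b → t * a ≤ k * suc b → ℕtoℚ t ℚ.* x ℚ.≤ ℕtoℚ k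
cross-≤⇒ℕ*≤ℕ {x} {a} {b} t k x≈ ta≤kb = cross-≤⇒≤ (*-≈ (ℕtoℚ≈ t) x≈) (ℕtoℚ≈ k)
  (subst₂ _≤_ (sym (*-identityʳ (t * a))) (cong (λ c → k * suc c) (sym (+-identityʳ b))) ta≤kb)

𝟙 : Bool → ℕ
𝟙 true  = 1
𝟙 false = 0

𝟙≤1 : ∀ b → 𝟙 b ≤ 1
𝟙≤1 true  = ≤-refl
𝟙≤1 false = z≤n

sumFin-cong : ∀ {n} {f g : Fin n → ℕ} → (∀ i → f i ≡ g i) → sumFin f ≡ sumFin g
sumFin-cong {zero}  f≗g = refl
sumFin-cong {suc n} f≗g = cong₂ _+_ (f≗g fzero) (sumFin-cong (f≗g ∘ fsuc))

sumFin-+ : ∀ {n} (f g : Fin n → ℕ) → sumFin (λ i → f i + g i) ≡ sumFin f + sumFin g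
sumFin-+ {zero}  f g = refl
sumFin-+ {suc n} f g = begin
  f fzero + g fzero + sumFin (λ i → f (fsuc i) + g (fsuc i))
    ≡⟨ cong (f fzero + g fzero +_) (sumFin-+ (f ∘ fsuc) (g ∘ fsuc)) ⟩
  f fzero + g fzero + (sumFin (f ∘ fsuc) + sumFin (g ∘ fsuc))
    ≡⟨ +-interchange (f fzero) (g fzero) (sumFin (f ∘ fsuc)) (sumFin (g ∘ fsuc)) ⟩
  f fzero + sumFin (f ∘ fsuc) + (g fzero + sumFin (g ∘ fsuc)) ∎
  where open ≡-Reasoning

sumFin-*ˡ : ∀ {n} c (f : Fin n → ℕ) → sumFin (λ i → c * f i) ≡ c * sumFin f
sumFin-*ˡ {zero}  c f = sym (*-zeroʳ c)
sumFin-*ˡ {suc n} c f = begin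
  c * f fzero + sumFin (λ i → c * f (fsuc i)) ≡⟨ cong (c * f fzero +_) (sumFin-*ˡ c (f ∘ fsuc)) ⟩
  c * f fzero + c * sumFin (f ∘ fsuc)         ≡⟨ *-distribˡ-+ c (f fzero) _ ⟨
  c * (f fzero + sumFin (f ∘ fsuc))           ∎
  where open ≡-Reasoning

sumFin-const : ∀ n c → sumFin {n} (λ _ → c) ≡ n * c
sumFin-const zero    c = refl
sumFin-const (suc n) c = cong (c +_) (sumFin-const n c)

sumFin-zero : ∀ n → sumFin {n} (λ _ → 0) ≡ 0
sumFin-zero n = trans (sumFin-const n 0) (*-zeroʳ n)

sumFin-mono-≤ : ∀ {n} {f g : Fin n → ℕ} → (∀ i → f i ≤ g i) → sumFin f ≤ sumFin g
sumFin-mono-≤ {zero}  f≤g = z≤n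
sumFin-mono-≤ {suc n} f≤g = +-mono-≤ (f≤g fzero) (sumFin-mono-≤ (f≤g ∘ fsuc))

sumFin-mono-< : ∀ {n} {f g : Fin n → ℕ} → (∀ i → f i ≤ g i) → ∀ v → f v < g v → sumFin f < sumFin g
sumFin-mono-< {suc n} f≤g fzero    fv<gv = +-mono-<-≤ fv<gv (sumFin-mono-≤ (f≤g ∘ fsuc))
sumFin-mono-< {suc n} f≤g (fsuc v) fv<gv = +-mono-≤-< (f≤g fzero) (sumFin-mono-< (f≤g ∘ fsuc) v fv<gv)

sumFin-comm : ∀ {m n} (f : Fin m → Fin n → ℕ) →
              sumFin (λ i → sumFin (f i)) ≡ sumFin (λ j → sumFin (λ i → f i j))
sumFin-comm {zero}  {n} f = sym (sumFin-zero n)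
sumFin-comm {suc m} {n} f = begin
  sumFin (f fzero) + sumFin (λ i → sumFin (f (fsuc i)))
    ≡⟨ cong (sumFin (f fzero) +_) (sumFin-comm (f ∘ fsuc)) ⟩
  sumFin (f fzero) + sumFin (λ j → sumFin (λ i → f (fsuc i) j))
    ≡⟨ sumFin-+ (f fzero) _ ⟨
  sumFin (λ j → f fzero j + sumFin (λ i → f (fsuc i) j)) ∎
  where open ≡-Reasoning

sumBelow : (ℕ → ℕ) → ℕ → ℕ
sumBelow f zero    = 0
sumBelow f (suc m) = sumBelow f m + f m

sumFin-sumBelow-comm : ∀ {n} (f : ℕ → Fin n → ℕ) m →
                       sumFin (λ i → sumBelow (λ j → f j i) m) ≡ sumBelow (λ j → sumFin (f j)) m
sumFin-sumBelow-comm {n} f zero    = sumFin-zero n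
sumFin-sumBelow-comm {n} f (suc m) =
  trans (sumFin-+ (λ i → sumBelow (λ j → f j i) m) (f m)) (cong (_+ sumFin (f m)) (sumFin-sumBelow-comm f m))

∣p∣≡sumFin : ∀ {n} (p : Subset n) → ∣ p ∣ ≡ sumFin (λ i → 𝟙 (lookup p i))
∣p∣≡sumFin []          = refl
∣p∣≡sumFin (true ∷ p)  = cong suc (∣p∣≡sumFin p)
∣p∣≡sumFin (false ∷ p) = ∣p∣≡sumFin p

sumBelow-cong : ∀ {f g : ℕ → ℕ} → (∀ j → f j ≡ g j) → ∀ m → sumBelow f m ≡ sumBelow g m
sumBelow-cong f≗g zero    = refl
sumBelow-cong f≗g (suc m) = cong₂ _+_ (sumBelow-cong f≗g m) (f≗g m)

*-sumBelow-≤ : ∀ c {b} (f : ℕ → ℕ) m → (∀ j → j < m → c * f j ≤ b) → c * sumBelow f m ≤ m * b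
*-sumBelow-≤ c {b} f zero    _       = ≤-reflexive (*-zeroʳ c)
*-sumBelow-≤ c {b} f (suc m) bounded = begin
  c * (sumBelow f m + f m)      ≡⟨ *-distribˡ-+ c (sumBelow f m) (f m) ⟩
  c * sumBelow f m + c * f m    ≤⟨ +-mono-≤ (*-sumBelow-≤ c f m (λ j j<m → bounded j (m<n⇒m<1+n j<m))) (bounded m ≤-refl) ⟩
  m * b + b                     ≡⟨ +-comm (m * b) b ⟩
  suc m * b                     ∎
  where open ≤-Reasoning

*-≤-sumBelow : ∀ {c E} a (x : ℕ → ℕ) t → 0 < t → c ≤ a * x 0 + E → (∀ k → 0 < k → k < t → c ≤ a * x k) →
               t * c ≤ a * sumBelow x t + E
*-≤-sumBelow {c} a x (suc zero)    _ first _     = subst (_≤ _) (sym (+-identityʳ c)) first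
*-≤-sumBelow {c} {E} a x (suc (suc m)) _ first later = begin
  c + suc m * c
    ≤⟨ +-mono-≤ (later (suc m) z<s ≤-refl)
                (*-≤-sumBelow a x (suc m) z<s first (λ k 0<k k<1+m → later k 0<k (m<n⇒m<1+n k<1+m))) ⟩
  a * x (suc m) + (a * sumBelow x (suc m) + E)
    ≡⟨ regroup a (x (suc m)) (sumBelow x (suc m)) E ⟩
  a * (sumBelow x (suc m) + x (suc m)) + E
    ∎
  where
  open ≤-Reasoning
  regroup : ∀ a y s e → a * y + (a * s + e) ≡ a * (s + y) + e
  regroup = solve-∀

lookup-∩ : ∀ {n} (p q : Subset n) i → lookup (p ∩ q) i ≡ (lookup p i ∧ lookup q i)
lookup-∩ p q i = lookup-zipWith _∧_ i p q

lookup-─ : ∀ {n} (p q : Subset n) i → lookup (p ─ q) i ≡ (lookup p i ∧ not (lookup q i))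
lookup-─ (x ∷ p) (true  ∷ q) fzero    = sym (∧-zeroʳ x)
lookup-─ (x ∷ p) (false ∷ q) fzero    = sym (∧-identityʳ x)
lookup-─ (_ ∷ p) (_     ∷ q) (fsuc i) = lookup-─ p q i

lookup-compl : ∀ {n} (p : Subset n) i → lookup (compl p) i ≡ not (lookup p i)
lookup-compl p i = lookup-map i not p

∣p∣+∣compl-p∣≡n : ∀ {n} (p : Subset n) → ∣ p ∣ + ∣ compl p ∣ ≡ n
∣p∣+∣compl-p∣≡n []          = refl
∣p∣+∣compl-p∣≡n (true  ∷ p) = cong suc (∣p∣+∣compl-p∣≡n p)
∣p∣+∣compl-p∣≡n (false ∷ p) = trans (+-suc _ _) (cong suc (∣p∣+∣compl-p∣≡n p))

∈⇒1≤∣p∣ : ∀ {n} (p : Subset n) i → lookup p i ≡ true → 1 ≤ ∣ p ∣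
∈⇒1≤∣p∣ (true ∷ p) fzero    _   = s≤s z≤n
∈⇒1≤∣p∣ (x    ∷ p) (fsuc i) i∈p = ≤-trans (∈⇒1≤∣p∣ p i i∈p) (∣p∣≤∣x∷p∣ x p)

module _ {n} (G : Graph n) where

  degIn≡sumFin : ∀ A u → degIn G A u ≡ sumFin (λ w → 𝟙 (adj G u w ∧ lookup A w))
  degIn≡sumFin A u = trans (∣p∣≡sumFin (nbhd G u ∩ A)) (sumFin-cong λ w →
    cong 𝟙 (trans (lookup-∩ (nbhd G u) A w) (cong (_∧ lookup A w) (lookup∘tabulate (adj G u) w))))

  deg≡sumFin : ∀ u → deg G u ≡ sumFin (λ w → 𝟙 (adj G u w))
  deg≡sumFin u = trans (∣p∣≡sumFin (nbhd G u)) (sumFin-cong λ w → cong 𝟙 (lookup∘tabulate (adj G u) w))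

  deg≡degIn+degIn-compl : ∀ A u → deg G u ≡ degIn G A u + degIn G (compl A) u
  deg≡degIn+degIn-compl A u = begin
    deg G u                                                                   ≡⟨ deg≡sumFin u ⟩
    sumFin (λ w → 𝟙 (adj G u w))                                              ≡⟨ sumFin-cong split ⟩
    sumFin (λ w → 𝟙 (adj G u w ∧ lookup A w) + 𝟙 (adj G u w ∧ lookup (compl A) w))
      ≡⟨ sumFin-+ (λ w → 𝟙 (adj G u w ∧ lookup A w)) (λ w → 𝟙 (adj G u w ∧ lookup (compl A) w)) ⟩
    sumFin (λ w → 𝟙 (adj G u w ∧ lookup A w)) + sumFin (λ w → 𝟙 (adj G u w ∧ lookup (compl A) w))
      ≡⟨ cong₂ _+_ (degIn≡sumFin A u) (degIn≡sumFin (compl A) u) ⟨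
    degIn G A u + degIn G (compl A) u                                         ∎
    where
    open ≡-Reasoning
    split : ∀ w → 𝟙 (adj G u w) ≡ 𝟙 (adj G u w ∧ lookup A w) + 𝟙 (adj G u w ∧ lookup (compl A) w)
    split w rewrite lookup-compl A w with adj G u w | lookup A w
    ... | true  | true  = refl
    ... | true  | false = refl
    ... | false | _     = refl

  degIn≤deg : ∀ A u → degIn G A u ≤ deg G u
  degIn≤deg A u = subst (degIn G A u ≤_) (sym (deg≡degIn+degIn-compl A u)) (m≤m+n _ _)

  -- A vertex is not its own neighbour.
  degIn<∣A∣ : ∀ A v → lookup A v ≡ true → degIn G A v < ∣ A ∣
  degIn<∣A∣ A v v∈A = begin-strict
    degIn G A v                                     ≡⟨ degIn≡sumFin A v ⟩
    sumFin (λ w → 𝟙 (adj G v w ∧ lookup A w))       <⟨ sumFin-mono-< edge≤member v loop<member ⟩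
    sumFin (λ w → 𝟙 (lookup A w))                   ≡⟨ ∣p∣≡sumFin A ⟨
    ∣ A ∣                                           ∎
    where
    open ≤-Reasoning
    edge≤member : ∀ w → 𝟙 (adj G v w ∧ lookup A w) ≤ 𝟙 (lookup A w)
    edge≤member w with adj G v w | lookup A w
    ... | true  | b = ≤-refl
    ... | false | b = z≤n
    loop<member : 𝟙 (adj G v v ∧ lookup A v) < 𝟙 (lookup A v)
    loop<member rewrite irrefl G v | v∈A = s≤s z≤n

  deg<n : ∀ v → deg G v < n
  deg<n v = begin-strict
    deg G v                      ≡⟨ deg≡sumFin v ⟩
    sumFin (λ w → 𝟙 (adj G v w)) <⟨ sumFin-mono-< (λ w → 𝟙≤1 (adj G v w)) v loop<1 ⟩
    sumFin {n} (λ _ → 1)         ≡⟨ sumFin-const n 1 ⟩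
    n * 1                        ≡⟨ *-identityʳ n ⟩
    n                            ∎
    where
    open ≤-Reasoning
    loop<1 : 𝟙 (adj G v v) < 1
    loop<1 rewrite irrefl G v = s≤s z≤n

  cut≡sumFin : ∀ A → cut G A ≡ sumFin (λ u → sumFin (λ w → 𝟙 (lookup A u ∧ (adj G u w ∧ not (lookup A w)))))
  cut≡sumFin A = sumFin-cong row
    where
    row : ∀ u → (if lookup A u then degIn G (compl A) u else 0) ≡
                sumFin (λ w → 𝟙 (lookup A u ∧ (adj G u w ∧ not (lookup A w))))
    row u with lookup A u
    ... | true  = trans (degIn≡sumFin (compl A) u) (sumFin-cong λ w → cong (λ b → 𝟙 (adj G u w ∧ b)) (lookup-compl A w))
    ... | false = sym (sumFin-zero n)

  cut-compl : ∀ A → cut G A ≡ cut G (compl A)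
  cut-compl A = begin
    cut G A                                                                        ≡⟨ cut≡sumFin A ⟩
    sumFin (λ u → sumFin (λ w → 𝟙 (lookup A u ∧ (adj G u w ∧ not (lookup A w)))))
      ≡⟨ sumFin-comm (λ u w → 𝟙 (lookup A u ∧ (adj G u w ∧ not (lookup A w)))) ⟩
    sumFin (λ w → sumFin (λ u → 𝟙 (lookup A u ∧ (adj G u w ∧ not (lookup A w)))))
      ≡⟨ sumFin-cong (λ w → sumFin-cong (λ u → reverse-edge w u)) ⟩
    sumFin (λ w → sumFin (λ u → 𝟙 (lookup (compl A) w ∧ (adj G w u ∧ not (lookup (compl A) u)))))
      ≡⟨ cut≡sumFin (compl A) ⟨
    cut G (compl A)                                                                ∎
    where
    open ≡-Reasoning
    swap-ends : ∀ a b e → (a ∧ (e ∧ not b)) ≡ (not b ∧ (e ∧ not (not a)))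
    swap-ends true  true  e     = ∧-zeroʳ e
    swap-ends true  false e     = refl
    swap-ends false true  e     = refl
    swap-ends false false e     = sym (∧-zeroʳ e)
    reverse-edge : ∀ w u → 𝟙 (lookup A u ∧ (adj G u w ∧ not (lookup A w))) ≡
                           𝟙 (lookup (compl A) w ∧ (adj G w u ∧ not (lookup (compl A) u)))
    reverse-edge w u rewrite lookup-compl A w | lookup-compl A u | Graph.sym G w u =
      cong 𝟙 (swap-ends (lookup A u) (lookup A w) (adj G u w))

  cut≤D*∣A∣ : ∀ {D} → Regular G D → ∀ A → cut G A ≤ D * ∣ A ∣
  cut≤D*∣A∣ {D} regular A = begin
    cut G A                                    ≤⟨ sumFin-mono-≤ row ⟩
    sumFin (λ u → D * 𝟙 (lookup A u))          ≡⟨ sumFin-*ˡ D (λ u → 𝟙 (lookup A u)) ⟩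
    D * sumFin (λ u → 𝟙 (lookup A u))          ≡⟨ cong (D *_) (∣p∣≡sumFin A) ⟨
    D * ∣ A ∣                                  ∎
    where
    open ≤-Reasoning
    row : ∀ u → (if lookup A u then degIn G (compl A) u else 0) ≤ D * 𝟙 (lookup A u)
    row u with lookup A u
    ... | true  = subst₂ _≤_ refl (trans (regular u) (sym (*-identityʳ D))) (degIn≤deg (compl A) u)
    ... | false = z≤n

bisection-bound : ∀ {n} (S : Subset n) → Bisection S → 2 * ∣ S ∣ ≤ suc n
bisection-bound {n} S (inj₁ ∣S∣≡n/2) = begin
  2 * ∣ S ∣    ≡⟨ cong (2 *_) ∣S∣≡n/2 ⟩
  2 * (n / 2)  ≡⟨ *-comm 2 (n / 2) ⟩
  n / 2 * 2    ≤⟨ m/n*n≤m n 2 ⟩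
  n            ≤⟨ n≤1+n n ⟩
  suc n        ∎
  where open ≤-Reasoning
bisection-bound {n} S (inj₂ ∣S∣≡n∸n/2) = begin
  2 * ∣ S ∣            ≡⟨ cong (2 *_) (trans ∣S∣≡n∸n/2 n∸h≡r+h) ⟩
  2 * (r + h)          ≡⟨ double r h ⟩
  r + (r + h * 2)      ≡⟨ cong (r +_) n≡r+h*2 ⟨
  r + n                ≤⟨ +-monoˡ-≤ n (≤-pred (m%n<n n 2)) ⟩
  suc n                ∎
  where
  open ≤-Reasoning
  r h : ℕ
  r = n % 2
  h = n / 2
  n≡r+h*2 : n ≡ r + h * 2
  n≡r+h*2 = m≡m%n+[m/n]*n n 2
  double : ∀ r h → 2 * (r + h) ≡ r + (r + h * 2)
  double = solve-∀
  n∸h≡r+h : n ∸ h ≡ r + h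
  n∸h≡r+h = begin-equality
    n ∸ h            ≡⟨ cong (_∸ h) (trans n≡r+h*2 (regroup r h)) ⟩
    r + h + h ∸ h    ≡⟨ m+n∸n≡m (r + h) h ⟩
    r + h            ∎
    where
    regroup : ∀ r h → r + h * 2 ≡ r + h + h
    regroup = solve-∀

module _ {n} (G : Graph n) {c d : ℕ} (expands : ∀ X → 0 < ∣ X ∣ → 2 * ∣ X ∣ ≤ n → c * ∣ X ∣ ≤ d * cut G X) where

  -- A set of size (n + 1)/2 is handled through its complement, at the price of one vertex.
  expands-up-to-half⁺ : ∀ X → 0 < ∣ X ∣ → 2 * ∣ X ∣ ≤ suc n → c * ∣ X ∣ ≤ d * cut G X + c
  expands-up-to-half⁺ X 0<∣X∣ 2∣X∣≤1+n with 2 * ∣ X ∣ ≤? n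
  ... | yes 2∣X∣≤n = ≤-trans (expands X 0<∣X∣ 2∣X∣≤n) (m≤m+n _ c)
  ... | no  2∣X∣≰n = begin
    c * ∣ X ∣                 ≡⟨ cong (c *_) ∣X∣≡1+∣X̄∣ ⟩
    c * suc ∣ compl X ∣       ≡⟨ trans (*-suc c _) (+-comm c _) ⟩
    c * ∣ compl X ∣ + c       ≤⟨ +-monoˡ-≤ c complement-expands ⟩
    d * cut G X + c           ∎
    where
    open ≤-Reasoning
    2∣X∣≡1+n : 2 * ∣ X ∣ ≡ suc n
    2∣X∣≡1+n = ≤-antisym 2∣X∣≤1+n (≰⇒> 2∣X∣≰n)
    ∣X∣≡1+∣X̄∣ : ∣ X ∣ ≡ suc ∣ compl X ∣
    ∣X∣≡1+∣X̄∣ = +-cancelˡ-≡ ∣ X ∣ _ _ (begin-equality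
      ∣ X ∣ + ∣ X ∣                 ≡⟨ cong (∣ X ∣ +_) (+-identityʳ ∣ X ∣) ⟨
      2 * ∣ X ∣                     ≡⟨ 2∣X∣≡1+n ⟩
      suc n                         ≡⟨ cong suc (∣p∣+∣compl-p∣≡n X) ⟨
      suc (∣ X ∣ + ∣ compl X ∣)     ≡⟨ +-suc ∣ X ∣ _ ⟨
      ∣ X ∣ + suc ∣ compl X ∣       ∎)
    2∣X̄∣≤n : 2 * ∣ compl X ∣ ≤ n
    2∣X̄∣≤n = <⇒≤ (≤-reflexive (suc-injective (begin-equality
      2 + 2 * ∣ compl X ∣    ≡⟨ *-suc 2 ∣ compl X ∣ ⟨
      2 * suc ∣ compl X ∣    ≡⟨ cong (2 *_) ∣X∣≡1+∣X̄∣ ⟨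
      2 * ∣ X ∣              ≡⟨ 2∣X∣≡1+n ⟩
      suc n                  ∎)))
    complement-expands : c * ∣ compl X ∣ ≤ d * cut G X
    complement-expands with ∣ compl X ∣ in ∣X̄∣≡
    ... | zero  = subst (_≤ d * cut G X) (sym (*-zeroʳ c)) z≤n
    ... | suc k = subst₂ (λ m cutX → c * m ≤ d * cutX) ∣X̄∣≡ (sym (cut-compl G X))
                    (expands (compl X) (subst (0 <_) (sym ∣X̄∣≡) z<s) 2∣X̄∣≤n)

downward-closed : (P : ℕ → Set) → (∀ k → P (suc k) → P k) → ∀ {k m} → k ≤ m → P m → P k
downward-closed P down {m = zero}  z≤n   Pm = Pm
downward-closed P down {m = suc m} k≤1+m Pm with m≤n⇒m<n∨m≡n k≤1+m
... | inj₁ k<1+m = downward-closed P down (≤-pred k<1+m) (down m Pm)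
... | inj₂ refl  = Pm

module Peeling {n} (G : Graph n) (θ : ℚ) (S : Subset n) where

  -- Abstract, so that rewriting never unfolds proc or the rational threshold test.
  abstract
    selected : Subset n → Fin n → Bool
    selected prev u = θ ℚ.≤ᵇ ℕtoℚ (degIn G prev u)

    selected≡ : ∀ prev u → selected prev u ≡ (θ ℚ.≤ᵇ ℕtoℚ (degIn G prev u))
    selected≡ prev u = refl

    S[_] : ℕ → Subset n
    S[ k ] = proj₁ (proc G θ S k)

    T[_] : ℕ → Subset n
    T[ k ] = Tafter G θ S k

    T≡Tafter : ∀ k → T[ k ] ≡ Tafter G θ S k
    T≡Tafter k = refl

    S[0]≡compl-S : S[ 0 ] ≡ compl S
    S[0]≡compl-S = refl

    T[0]≡S : T[ 0 ] ≡ S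
    T[0]≡S = refl

    lookup-S-suc : ∀ k u → lookup S[ suc k ] u ≡ (lookup T[ k ] u ∧ selected S[ k ] u)
    lookup-S-suc k u = trans (lookup-∩ T[ k ] _ u) (cong (lookup T[ k ] u ∧_) (lookup∘tabulate (selected S[ k ]) u))

    lookup-T-suc : ∀ k u → lookup T[ suc k ] u ≡ (lookup T[ k ] u ∧ not (selected S[ k ] u))
    lookup-T-suc k u = begin
      lookup T[ suc k ] u                                       ≡⟨ lookup-─ T[ k ] S[ suc k ] u ⟩
      lookup T[ k ] u ∧ not (lookup S[ suc k ] u)               ≡⟨ cong (λ b → lookup T[ k ] u ∧ not b) (lookup-S-suc k u) ⟩
      lookup T[ k ] u ∧ not (lookup T[ k ] u ∧ selected S[ k ] u) ≡⟨ keep (lookup T[ k ] u) (selected S[ k ] u) ⟩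
      lookup T[ k ] u ∧ not (selected S[ k ] u)                 ∎
      where
      open ≡-Reasoning
      keep : ∀ a b → (a ∧ not (a ∧ b)) ≡ (a ∧ not b)
      keep true  b = refl
      keep false b = refl

  ∣T∣≡∣S-suc∣+∣T-suc∣ : ∀ k → ∣ T[ k ] ∣ ≡ ∣ S[ suc k ] ∣ + ∣ T[ suc k ] ∣
  ∣T∣≡∣S-suc∣+∣T-suc∣ k = begin
    ∣ T[ k ] ∣                                  ≡⟨ ∣p∣≡sumFin T[ k ] ⟩
    sumFin (λ u → 𝟙 (lookup T[ k ] u))          ≡⟨ sumFin-cong split ⟩
    sumFin (λ u → 𝟙 (lookup S[ suc k ] u) + 𝟙 (lookup T[ suc k ] u))
      ≡⟨ sumFin-+ (λ u → 𝟙 (lookup S[ suc k ] u)) (λ u → 𝟙 (lookup T[ suc k ] u)) ⟩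
    sumFin (λ u → 𝟙 (lookup S[ suc k ] u)) + sumFin (λ u → 𝟙 (lookup T[ suc k ] u))
      ≡⟨ cong₂ _+_ (∣p∣≡sumFin S[ suc k ]) (∣p∣≡sumFin T[ suc k ]) ⟨
    ∣ S[ suc k ] ∣ + ∣ T[ suc k ] ∣             ∎
    where
    open ≡-Reasoning
    split : ∀ u → 𝟙 (lookup T[ k ] u) ≡ 𝟙 (lookup S[ suc k ] u) + 𝟙 (lookup T[ suc k ] u)
    split u rewrite lookup-S-suc k u | lookup-T-suc k u with lookup T[ k ] u | selected S[ k ] u
    ... | true  | true  = refl
    ... | true  | false = refl
    ... | false | _     = refl

  ∣T-suc∣≤∣T∣ : ∀ k → ∣ T[ suc k ] ∣ ≤ ∣ T[ k ] ∣
  ∣T-suc∣≤∣T∣ k = subst (∣ T[ suc k ] ∣ ≤_) (sym (∣T∣≡∣S-suc∣+∣T-suc∣ k)) (m≤n+m _ _)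

  ∣T∣-antitone : ∀ {k m} → k ≤ m → ∣ T[ m ] ∣ ≤ ∣ T[ k ] ∣
  ∣T∣-antitone {m = m} k≤m =
    downward-closed (λ i → ∣ T[ m ] ∣ ≤ ∣ T[ i ] ∣) (λ i → flip ≤-trans (∣T-suc∣≤∣T∣ i)) k≤m ≤-refl

  T-suc⊆T : ∀ k u → lookup T[ suc k ] u ≡ true → lookup T[ k ] u ≡ true
  T-suc⊆T k u u∈T-suc rewrite lookup-T-suc k u with lookup T[ k ] u
  ... | true  = refl
  ... | false = u∈T-suc

  T-antitone : ∀ {k m} u → k ≤ m → lookup T[ m ] u ≡ true → lookup T[ k ] u ≡ true
  T-antitone u = downward-closed (λ i → lookup T[ i ] u ≡ true) (λ i → T-suc⊆T i u)

  T-suc⇒unselected : ∀ k u → lookup T[ suc k ] u ≡ true → selected S[ k ] u ≡ false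
  T-suc⇒unselected k u u∈T-suc rewrite lookup-T-suc k u with lookup T[ k ] u | selected S[ k ] u
  ... | true  | false = refl
  ... | true  | true  = sym u∈T-suc
  ... | false | _     = contradiction u∈T-suc λ ()

  sumBelow-∣S-suc∣+∣T∣≡∣S∣ : ∀ m → sumBelow (λ k → ∣ S[ suc k ] ∣) m + ∣ T[ m ] ∣ ≡ ∣ S ∣
  sumBelow-∣S-suc∣+∣T∣≡∣S∣ zero    = cong ∣_∣ T[0]≡S
  sumBelow-∣S-suc∣+∣T∣≡∣S∣ (suc m) = begin
    removed + ∣ S[ suc m ] ∣ + ∣ T[ suc m ] ∣   ≡⟨ +-assoc removed ∣ S[ suc m ] ∣ ∣ T[ suc m ] ∣ ⟩
    removed + (∣ S[ suc m ] ∣ + ∣ T[ suc m ] ∣) ≡⟨ cong (removed +_) (∣T∣≡∣S-suc∣+∣T-suc∣ m) ⟨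
    removed + ∣ T[ m ] ∣                       ≡⟨ sumBelow-∣S-suc∣+∣T∣≡∣S∣ m ⟩
    ∣ S ∣                                      ∎
    where
    open ≡-Reasoning
    removed : ℕ
    removed = sumBelow (λ k → ∣ S[ suc k ] ∣) m

  -- S[ 0 ], …, S[ k ] partition the complement of T[ k ].
  𝟙-∉T≡sumBelow-𝟙-∈S : ∀ a k w → 𝟙 (a ∧ not (lookup T[ k ] w)) ≡ sumBelow (λ j → 𝟙 (a ∧ lookup S[ j ] w)) (suc k)
  𝟙-∉T≡sumBelow-𝟙-∈S a zero    w rewrite T[0]≡S | S[0]≡compl-S = cong (λ b → 𝟙 (a ∧ b)) (sym (lookup-compl S w))
  𝟙-∉T≡sumBelow-𝟙-∈S a (suc k) w = begin
    𝟙 (a ∧ not (lookup T[ suc k ] w))                                  ≡⟨ split ⟩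
    𝟙 (a ∧ not (lookup T[ k ] w)) + 𝟙 (a ∧ lookup S[ suc k ] w)
      ≡⟨ cong (_+ 𝟙 (a ∧ lookup S[ suc k ] w)) (𝟙-∉T≡sumBelow-𝟙-∈S a k w) ⟩
    sumBelow (λ j → 𝟙 (a ∧ lookup S[ j ] w)) (suc (suc k))             ∎
    where
    open ≡-Reasoning
    split : 𝟙 (a ∧ not (lookup T[ suc k ] w)) ≡ 𝟙 (a ∧ not (lookup T[ k ] w)) + 𝟙 (a ∧ lookup S[ suc k ] w)
    split rewrite lookup-S-suc k w | lookup-T-suc k w = peel a (lookup T[ k ] w) (selected S[ k ] w)
      where
      peel : ∀ a t s → 𝟙 (a ∧ not (t ∧ not s)) ≡ 𝟙 (a ∧ not t) + 𝟙 (a ∧ (t ∧ s))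
      peel false _     _     = refl
      peel true  false _     = refl
      peel true  true  true  = refl
      peel true  true  false = refl

  degIn-compl-T : ∀ k u → degIn G (compl T[ k ]) u ≡ sumBelow (λ j → degIn G S[ j ] u) (suc k)
  degIn-compl-T k u = begin
    degIn G (compl T[ k ]) u
      ≡⟨ degIn≡sumFin G (compl T[ k ]) u ⟩
    sumFin (λ w → 𝟙 (adj G u w ∧ lookup (compl T[ k ]) w))
      ≡⟨ sumFin-cong (λ w → trans (cong (λ b → 𝟙 (adj G u w ∧ b)) (lookup-compl T[ k ] w))
                                  (𝟙-∉T≡sumBelow-𝟙-∈S (adj G u w) k w)) ⟩
    sumFin (λ w → sumBelow (λ j → 𝟙 (adj G u w ∧ lookup S[ j ] w)) (suc k))
      ≡⟨ sumFin-sumBelow-comm (λ j w → 𝟙 (adj G u w ∧ lookup S[ j ] w)) (suc k) ⟩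
    sumBelow (λ j → sumFin (λ w → 𝟙 (adj G u w ∧ lookup S[ j ] w))) (suc k)
      ≡⟨ sumBelow-cong (λ j → sym (degIn≡sumFin G S[ j ] u)) (suc k) ⟩
    sumBelow (λ j → degIn G S[ j ] u) (suc k)
      ∎
    where open ≡-Reasoning

  module _ {D P Q : ℕ} (regular : Regular G D)
           (below-threshold : ∀ d → (θ ℚ.≤ᵇ ℕtoℚ d) ≡ false → Q * d < P) where

    survivor-degIn-compl-T : ∀ k u → lookup T[ suc k ] u ≡ true → Q * degIn G (compl T[ k ]) u ≤ suc k * P
    survivor-degIn-compl-T k u u∈T = begin
      Q * degIn G (compl T[ k ]) u                    ≡⟨ cong (Q *_) (degIn-compl-T k u) ⟩
      Q * sumBelow (λ j → degIn G S[ j ] u) (suc k)   ≤⟨ *-sumBelow-≤ Q (λ j → degIn G S[ j ] u) (suc k) unselected-before ⟩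
      suc k * P                                       ∎
      where
      open ≤-Reasoning
      unselected-before : ∀ j → j < suc k → Q * degIn G S[ j ] u ≤ P
      unselected-before j j<1+k = <⇒≤ (below-threshold _
        (trans (sym (selected≡ S[ j ] u)) (T-suc⇒unselected j u (T-antitone u j<1+k u∈T))))

    cut-T≤ : ∀ k → Q * cut G T[ k ] ≤ Q * D * ∣ S[ suc k ] ∣ + suc k * P * ∣ T[ suc k ] ∣
    cut-T≤ k = begin
      Q * cut G T[ k ]
        ≡⟨ sumFin-*ˡ Q (λ u → if lookup T[ k ] u then degIn G (compl T[ k ]) u else 0) ⟨
      sumFin (λ u → Q * (if lookup T[ k ] u then degIn G (compl T[ k ]) u else 0))
        ≤⟨ sumFin-mono-≤ row ⟩
      sumFin (λ u → Q * D * 𝟙 (lookup S[ suc k ] u) + suc k * P * 𝟙 (lookup T[ suc k ] u))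
        ≡⟨ sumFin-+ (λ u → Q * D * 𝟙 (lookup S[ suc k ] u)) (λ u → suc k * P * 𝟙 (lookup T[ suc k ] u)) ⟩
      sumFin (λ u → Q * D * 𝟙 (lookup S[ suc k ] u)) + sumFin (λ u → suc k * P * 𝟙 (lookup T[ suc k ] u))
        ≡⟨ cong₂ _+_ (sumFin-*ˡ (Q * D) (λ u → 𝟙 (lookup S[ suc k ] u)))
                     (sumFin-*ˡ (suc k * P) (λ u → 𝟙 (lookup T[ suc k ] u))) ⟩
      Q * D * sumFin (λ u → 𝟙 (lookup S[ suc k ] u)) + suc k * P * sumFin (λ u → 𝟙 (lookup T[ suc k ] u))
        ≡⟨ cong₂ (λ s t → Q * D * s + suc k * P * t) (∣p∣≡sumFin S[ suc k ]) (∣p∣≡sumFin T[ suc k ]) ⟨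
      Q * D * ∣ S[ suc k ] ∣ + suc k * P * ∣ T[ suc k ] ∣
        ∎
      where
      open ≤-Reasoning
      row : ∀ u → Q * (if lookup T[ k ] u then degIn G (compl T[ k ]) u else 0) ≤
                  Q * D * 𝟙 (lookup S[ suc k ] u) + suc k * P * 𝟙 (lookup T[ suc k ] u)
      row u rewrite lookup-S-suc k u | lookup-T-suc k u with lookup T[ k ] u in u∈T | selected S[ k ] u in sel
      ... | false | _     = ≤-trans (≤-reflexive (*-zeroʳ Q)) z≤n
      ... | true  | true  = begin
        Q * degIn G (compl T[ k ]) u   ≤⟨ *-monoʳ-≤ Q (subst (degIn G (compl T[ k ]) u ≤_) (regular u) (degIn≤deg G (compl T[ k ]) u)) ⟩
        Q * D                          ≡⟨ *-identityʳ (Q * D) ⟨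
        Q * D * 1                      ≤⟨ m≤m+n (Q * D * 1) _ ⟩
        Q * D * 1 + suc k * P * 0      ∎
      ... | true  | false = begin
        Q * degIn G (compl T[ k ]) u   ≤⟨ survivor-degIn-compl-T k u u∈T-suc ⟩
        suc k * P                      ≡⟨ *-identityʳ (suc k * P) ⟨
        suc k * P * 1                  ≤⟨ m≤n+m (suc k * P * 1) _ ⟩
        Q * D * 0 + suc k * P * 1      ∎
        where
        u∈T-suc : lookup T[ suc k ] u ≡ true
        u∈T-suc = trans (lookup-T-suc k u) (cong₂ (λ t s → t ∧ not s) u∈T sel)

    survivor-∣T∣ : ∀ {t} v → lookup T[ t ] v ≡ true → ∀ k → k < t → Q * D + Q ≤ Q * ∣ T[ k ] ∣ + suc k * P
    survivor-∣T∣ {t} v v∈T k k<t = begin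
      Q * D + Q
        ≡⟨ cong (λ d → Q * d + Q) (trans (sym (regular v)) (deg≡degIn+degIn-compl G T[ k ] v)) ⟩
      Q * (degIn G T[ k ] v + degIn G (compl T[ k ]) v) + Q
        ≡⟨ regroup Q (degIn G T[ k ] v) (degIn G (compl T[ k ]) v) ⟩
      Q * suc (degIn G T[ k ] v) + Q * degIn G (compl T[ k ]) v
        ≤⟨ +-mono-≤ (*-monoʳ-≤ Q (degIn<∣A∣ G T[ k ] v (T-antitone v (<⇒≤ k<t) v∈T)))
                    (survivor-degIn-compl-T k v (T-antitone v k<t v∈T)) ⟩
      Q * ∣ T[ k ] ∣ + suc k * P
        ∎
      where
      open ≤-Reasoning
      regroup : ∀ q a b → q * (a + b) + q ≡ q * suc a + q * b
      regroup = solve-∀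

ceiling-multiple : ∀ A B → 0 < A → A ≤ B → ∃ λ t → B ≤ t * A × t * A ≤ 2 * B
ceiling-multiple A B 0<A A≤B =
  let t , B≤tA , tA<B+A = least-multiple-above B
  in t , B≤tA , ≤-trans (<⇒≤ tA<B+A) (≤-trans (+-monoʳ-≤ B A≤B) (≤-reflexive (cong (B +_) (sym (+-identityʳ B)))))
  where
  least-multiple-above : ∀ B → ∃ λ t → B ≤ t * A × t * A < B + A
  least-multiple-above zero    = 0 , z≤n , 0<A
  least-multiple-above (suc B) with least-multiple-above B
  ... | t , B≤tA , tA<B+A with suc B ≤? t * A
  ...   | yes B<tA = t , B<tA , <-≤-trans tA<B+A (n≤1+n (B + A))
  ...   | no  B≮tA rewrite ≤-antisym B≤tA (≤-pred (≰⇒> B≮tA)) =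
          suc t , +-monoˡ-≤ (t * A) 0<A , ≤-reflexive (cong suc (+-comm A (t * A)))

-- x (4 - x)² ≥ 8 for 1 ≤ x ≤ 2, scaled by B: write B = d + e and X = B + d.
16B³≤2XW² : ∀ B X W → B ≤ X → X ≤ 2 * B → W + X ≡ 4 * B → 16 * B * B * B ≤ 2 * X * W * W
16B³≤2XW² B X W B≤X X≤2B W+X≡4B with m≤n⇒∃[o]m+o≡n B≤X
... | d , refl with m≤n⇒∃[o]m+o≡n (+-cancelˡ-≤ B d B (subst (B + d ≤_) (cong (B +_) (+-identityʳ B)) X≤2B))
... | e , refl with +-cancelʳ-≡ (d + e + d) W (2 * d + 3 * e) (trans W+X≡4B (split d e))
  where
  split : ∀ d e → 4 * (d + e) ≡ 2 * d + 3 * e + (d + e + d)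
  split = solve-∀
... | refl = subst (16 * (d + e) * (d + e) * (d + e) ≤_) (sym (expand d e)) (m≤m+n _ _)
  where
  expand : ∀ d e → 2 * (d + e + d) * (2 * d + 3 * e) * (2 * d + 3 * e) ≡
                   16 * (d + e) * (d + e) * (d + e) + (8 * d * d * e + 12 * d * e * e + 2 * e * e * e)
  expand = solve-∀

-- With β = p₁/q₁ and γ = p₂/q₂ one has βγ = A/B and θ = βγ²D/4 = P/Q.
module Rates (p₁ q₁ p₂ q₂ D : ℕ)
             {{_ : NonZero p₁}} {{_ : NonZero q₁}} {{_ : NonZero p₂}} {{_ : NonZero q₂}} {{_ : NonZero D}} where

  A B P Q : ℕ
  A = p₁ * p₂
  B = q₁ * q₂
  P = p₁ * p₂ * p₂ * D
  Q = 4 * q₁ * q₂ * q₂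

  instance
    q₂*D≢0 : NonZero (q₂ * D)
    q₂*D≢0 = m*n≢0 q₂ D
    B≢0 : NonZero B
    B≢0 = m*n≢0 q₁ q₂
    Q≢0 : NonZero Q
    Q≢0 = m*n≢0 (4 * q₁ * q₂) q₂ {{m*n≢0 (4 * q₁) q₂ {{m*n≢0 4 q₁}}}}
    4BQ≢0 : NonZero (4 * B * Q)
    4BQ≢0 = m*n≢0 (4 * B) Q {{m*n≢0 4 B}}

  -- W stands for (4 - mβγ)B.
  removal-bound : ∀ {m W y x e c} → W + m * A ≡ 4 * B →
                  Q * c ≤ Q * D * x + m * P * y → p₂ * D * y ≤ q₂ * c + p₂ * D * e →
                  p₂ * W * y ≤ Q * x + 4 * B * p₂ * e
  removal-bound {m} {W} {y} {x} {e} {c} W+mA≡4B cut≤ expansion =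
    *-cancelˡ-≤ (q₂ * D) (+-cancelʳ-≤ (q₂ * D * (p₂ * y * (m * A))) _ _ (begin
      q₂ * D * (p₂ * W * y) + q₂ * D * (p₂ * y * (m * A)) ≡⟨ factor q₂ D p₂ y W (m * A) ⟩
      q₂ * D * p₂ * y * (W + m * A)                       ≡⟨ cong (q₂ * D * p₂ * y *_) W+mA≡4B ⟩
      q₂ * D * p₂ * y * (4 * B)                           ≡⟨ as-Q p₁ q₁ p₂ q₂ D y ⟩
      Q * (p₂ * D * y)                                    ≤⟨ *-monoʳ-≤ Q expansion ⟩
      Q * (q₂ * c + p₂ * D * e)                           ≡⟨ distrib Q q₂ c (p₂ * D * e) ⟩
      q₂ * (Q * c) + Q * (p₂ * D * e)                     ≤⟨ +-monoˡ-≤ (Q * (p₂ * D * e)) (*-monoʳ-≤ q₂ cut≤) ⟩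
      q₂ * (Q * D * x + m * P * y) + Q * (p₂ * D * e)     ≡⟨ regroup p₁ q₁ p₂ q₂ D m x y e ⟩
      q₂ * D * (Q * x + 4 * B * p₂ * e) + q₂ * D * (p₂ * y * (m * A)) ∎))
    where
    open ≤-Reasoning
    factor : ∀ q d p y w a → q * d * (p * w * y) + q * d * (p * y * a) ≡ q * d * p * y * (w + a)
    factor = solve-∀
    as-Q : ∀ p₁ q₁ p₂ q₂ D y → q₂ * D * p₂ * y * (4 * (q₁ * q₂)) ≡ 4 * q₁ * q₂ * q₂ * (p₂ * D * y)
    as-Q = solve-∀
    distrib : ∀ a q c f → a * (q * c + f) ≡ q * (a * c) + a * f
    distrib = solve-∀
    regroup : ∀ p₁ q₁ p₂ q₂ D m x y e →
      q₂ * (4 * q₁ * q₂ * q₂ * D * x + m * (p₁ * p₂ * p₂ * D) * y) + 4 * q₁ * q₂ * q₂ * (p₂ * D * e) ≡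
      q₂ * D * (4 * q₁ * q₂ * q₂ * x + 4 * (q₁ * q₂) * p₂ * e) + q₂ * D * (p₂ * y * (m * (p₁ * p₂)))
    regroup = solve-∀

  survivor-lower-bound : ∀ {m W y} → p₂ ≤ q₂ → W + m * A ≡ 4 * B →
                         Q * D + Q ≤ Q * y + m * P → W * D + 4 * B ≤ 4 * B * y
  survivor-lower-bound {m} {W} {y} p₂≤q₂ W+mA≡4B survivor =
    +-cancelʳ-≤ (m * A * D) _ _ (begin
      W * D + 4 * B + m * A * D   ≡⟨ distrib W (m * A) D (4 * B) ⟩
      (W + m * A) * D + 4 * B     ≡⟨ cong (λ w → w * D + 4 * B) W+mA≡4B ⟩
      4 * B * D + 4 * B           ≤⟨ *-cancelˡ-≤ q₂ scaled ⟩
      4 * B * y + m * A * D       ∎)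
    where
    open ≤-Reasoning
    distrib : ∀ w a d b → w * d + b + a * d ≡ (w + a) * d + b
    distrib = solve-∀
    scaled : q₂ * (4 * B * D + 4 * B) ≤ q₂ * (4 * B * y + m * A * D)
    scaled = begin
      q₂ * (4 * B * D + 4 * B)               ≡⟨ as-Q q₁ q₂ D ⟩
      Q * D + Q                              ≤⟨ survivor ⟩
      Q * y + m * P                          ≤⟨ +-monoʳ-≤ (Q * y) (*-monoʳ-≤ m (*-monoˡ-≤ D (*-monoʳ-≤ A p₂≤q₂))) ⟩
      Q * y + m * (A * q₂ * D)               ≡⟨ factor p₁ q₁ p₂ q₂ D m y ⟩
      q₂ * (4 * B * y + m * A * D)           ∎
      where
      as-Q : ∀ q₁ q₂ D → q₂ * (4 * (q₁ * q₂) * D + 4 * (q₁ * q₂)) ≡ 4 * q₁ * q₂ * q₂ * D + 4 * q₁ * q₂ * q₂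
      as-Q = solve-∀
      factor : ∀ p₁ q₁ p₂ q₂ D m y →
        4 * q₁ * q₂ * q₂ * y + m * (p₁ * p₂ * q₂ * D) ≡ q₂ * (4 * (q₁ * q₂) * y + m * (p₁ * p₂) * D)
      factor = solve-∀

  first-round-removes : ∀ {W y} → A < B → 2 ≤ y → W + 1 * A ≡ 4 * B → ¬ (p₂ * W * y ≤ Q * 0 + 4 * B * p₂ * 1)
  first-round-removes {W} {y} A<B 2≤y W+A≡4B removal = <-irrefl refl (begin-strict
    2 * (4 * B)          ≡⟨ cong (2 *_) W+A≡4B ⟨
    2 * (W + 1 * A)      ≡⟨ expand W A ⟩
    W * 2 + 2 * A        ≤⟨ +-monoˡ-≤ (2 * A) 2W≤4B ⟩
    4 * B + 2 * A        <⟨ +-monoʳ-< (4 * B) (*-monoʳ-< 2 A<B) ⟩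
    4 * B + 2 * B        ≤⟨ +-monoʳ-≤ (4 * B) (*-monoˡ-≤ B {2} {4} (s≤s (s≤s z≤n))) ⟩
    4 * B + 4 * B        ≡⟨ cong (4 * B +_) (+-identityʳ (4 * B)) ⟨
    2 * (4 * B)          ∎)
    where
    open ≤-Reasoning
    expand : ∀ w a → 2 * (w + 1 * a) ≡ w * 2 + 2 * a
    expand = solve-∀
    2W≤4B : W * 2 ≤ 4 * B
    2W≤4B = *-cancelˡ-≤ p₂ (begin
      p₂ * (W * 2)         ≤⟨ *-monoʳ-≤ p₂ (*-monoʳ-≤ W 2≤y) ⟩
      p₂ * (W * y)         ≡⟨ *-assoc p₂ W y ⟨
      p₂ * W * y           ≤⟨ removal ⟩
      Q * 0 + 4 * B * p₂ * 1 ≡⟨ cong₂ _+_ (*-zeroʳ Q) (trans (*-identityʳ (4 * B * p₂)) (*-comm (4 * B) p₂)) ⟩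
      p₂ * (4 * B)         ∎)

  survival-impossible : ∀ {t W X n} → 2 ≤ t → B ≤ t * A → t * A ≤ 2 * B → W + t * A ≡ 4 * B →
                        p₁ * n ≤ q₁ * D → 2 * X < n →
                        ¬ (t * (p₂ * W * (W * D + 4 * B)) ≤ 4 * B * Q * X + 4 * B * (4 * B * p₂))
  survival-impossible {t} {W} {X} {n} 2≤t B≤tA tA≤2B W+tA≡4B p₁n≤q₁D 2X<n total =
    <⇒≱ (*-cancelˡ-< D _ _ scaled) (16B³≤2XW² B (t * A) W B≤tA tA≤2B W+tA≡4B)
    where
    open ≤-Reasoning
    2B≤W : 2 * B ≤ W
    2B≤W = +-cancelʳ-≤ (t * A) (2 * B) W (begin
      2 * B + t * A        ≤⟨ +-monoʳ-≤ (2 * B) tA≤2B ⟩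
      2 * B + 2 * B        ≡⟨ double B ⟩
      4 * B                ≡⟨ W+tA≡4B ⟨
      W + t * A            ∎)
      where
      double : ∀ b → 2 * b + 2 * b ≡ 4 * b
      double = solve-∀
    -- The vertex lost in the first round (see expands-up-to-half⁺) is paid for by the 4B terms.
    error≤slack : 4 * B * (4 * B * p₂) ≤ t * (p₂ * W * (4 * B))
    error≤slack = begin
      4 * B * (4 * B * p₂)         ≡⟨ regroup B p₂ ⟩
      2 * (p₂ * (2 * B) * (4 * B)) ≤⟨ *-mono-≤ 2≤t (*-monoˡ-≤ (4 * B) (*-monoʳ-≤ p₂ 2B≤W)) ⟩
      t * (p₂ * W * (4 * B))       ∎
      where
      regroup : ∀ b p → 4 * b * (4 * b * p) ≡ 2 * (p * (2 * b) * (4 * b))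
      regroup = solve-∀
    quadratic : t * (p₂ * W * (W * D)) ≤ 4 * B * Q * X
    quadratic = +-cancelʳ-≤ (t * (p₂ * W * (4 * B))) _ _ (begin
      t * (p₂ * W * (W * D)) + t * (p₂ * W * (4 * B)) ≡⟨ distrib t p₂ W D B ⟩
      t * (p₂ * W * (W * D + 4 * B))                  ≤⟨ total ⟩
      4 * B * Q * X + 4 * B * (4 * B * p₂)            ≤⟨ +-monoʳ-≤ (4 * B * Q * X) error≤slack ⟩
      4 * B * Q * X + t * (p₂ * W * (4 * B))          ∎)
      where
      distrib : ∀ t p w d b → t * (p * w * (w * d)) + t * (p * w * (4 * b)) ≡ t * (p * w * (w * d + 4 * b))
      distrib = solve-∀
    -- Multiplying by 2p₁ and using 2p₁X < p₁n ≤ q₁D gives 2tA·W² < 16B³, against 16B³≤2XW².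
    scaled : D * (2 * (t * A) * W * W) < D * (16 * B * B * B)
    scaled = begin-strict
      D * (2 * (t * A) * W * W)               ≡⟨ regroup₁ p₁ p₂ D t W ⟩
      2 * p₁ * (t * (p₂ * W * (W * D)))       ≤⟨ *-monoʳ-≤ (2 * p₁) quadratic ⟩
      2 * p₁ * (4 * B * Q * X)                ≡⟨ regroup₂ p₁ (4 * B * Q) X ⟩
      4 * B * Q * (2 * X * p₁)                <⟨ *-monoʳ-< (4 * B * Q) (*-monoˡ-< p₁ 2X<n) ⟩
      4 * B * Q * (n * p₁)                    ≤⟨ *-monoʳ-≤ (4 * B * Q) (subst (_≤ q₁ * D) (*-comm p₁ n) p₁n≤q₁D) ⟩
      4 * B * Q * (q₁ * D)                    ≡⟨ regroup₃ q₁ q₂ D ⟩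
      D * (16 * B * B * B)                    ∎
      where
      regroup₁ : ∀ p₁ p₂ D t W → D * (2 * (t * (p₁ * p₂)) * W * W) ≡ 2 * p₁ * (t * (p₂ * W * (W * D)))
      regroup₁ = solve-∀
      regroup₂ : ∀ p c x → 2 * p * (c * x) ≡ c * (2 * x * p)
      regroup₂ = solve-∀
      regroup₃ : ∀ q₁ q₂ D → 4 * (q₁ * q₂) * (4 * q₁ * q₂ * q₂) * (q₁ * D) ≡
                             D * (16 * (q₁ * q₂) * (q₁ * q₂) * (q₁ * q₂))
      regroup₃ = solve-∀

module Termination {n} (G : Graph n) {D : ℕ} (regular : Regular G D) (S : Subset n) (bisection : Bisection S) (θ : ℚ)
            (p₁ q₁ p₂ q₂ : ℕ) {{_ : NonZero p₁}} {{_ : NonZero q₁}} {{_ : NonZero p₂}} {{_ : NonZero q₂}} {{_ : NonZero D}}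
            (β-bound : p₁ * n ≤ q₁ * D)
            (expands : ∀ X → 0 < ∣ X ∣ → 2 * ∣ X ∣ ≤ n → p₂ * D * ∣ X ∣ ≤ q₂ * cut G X)
            (below-threshold : ∀ d → (θ ℚ.≤ᵇ ℕtoℚ d) ≡ false → 4 * q₁ * q₂ * q₂ * d < p₁ * p₂ * p₂ * D) where

  open Rates p₁ q₁ p₂ q₂ D
  open Peeling G θ S

  D<n : Fin n → D < n
  D<n v = subst (_< n) (regular v) (deg<n G v)

  p₁<q₁ : Fin n → p₁ < q₁
  p₁<q₁ v = *-cancelʳ-< n p₁ q₁ (≤-<-trans β-bound (*-monoʳ-< q₁ (D<n v)))

  -- Expansion of a single vertex v: γ D ≤ |E(v, V ∖ v)| = D.
  p₂≤q₂ : Fin n → p₂ ≤ q₂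
  p₂≤q₂ v = *-cancelʳ-≤ p₂ q₂ D (singleton-expands (∣⁅x⁆∣≡1 v))
    where
    open ≤-Reasoning
    singleton-expands : ∣ ⁅ v ⁆ ∣ ≡ 1 → p₂ * D ≤ q₂ * D
    singleton-expands ∣⁅v⁆∣≡1 = begin
      p₂ * D                 ≡⟨ *-identityʳ (p₂ * D) ⟨
      p₂ * D * 1             ≡⟨ cong (p₂ * D *_) ∣⁅v⁆∣≡1 ⟨
      p₂ * D * ∣ ⁅ v ⁆ ∣     ≤⟨ expands ⁅ v ⁆ (≤-reflexive (sym ∣⁅v⁆∣≡1))
                                  (subst (λ s → 2 * s ≤ n) (sym ∣⁅v⁆∣≡1) (≤-trans (s≤s (>-nonZero⁻¹ D)) (D<n v))) ⟩
      q₂ * cut G ⁅ v ⁆       ≤⟨ *-monoʳ-≤ q₂ (cut≤D*∣A∣ G regular ⁅ v ⁆) ⟩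
      q₂ * (D * ∣ ⁅ v ⁆ ∣)   ≡⟨ cong (λ s → q₂ * (D * s)) ∣⁅v⁆∣≡1 ⟩
      q₂ * (D * 1)           ≡⟨ cong (q₂ *_) (*-identityʳ D) ⟩
      q₂ * D                 ∎

  A<B : Fin n → A < B
  A<B v = <-≤-trans (*-monoˡ-< p₂ (p₁<q₁ v)) (*-monoʳ-≤ q₁ (p₂≤q₂ v))

  module Survivor {t} (B≤tA : B ≤ t * A) (tA≤2B : t * A ≤ 2 * B) (v : Fin n) (v∈T : lookup T[ t ] v ≡ true) where

    2≤t : 2 ≤ t
    2≤t = at-least-two t B≤tA
      where
      at-least-two : ∀ t → B ≤ t * A → 2 ≤ t
      at-least-two zero          B≤0  = contradiction B≤0 (<⇒≱ (>-nonZero⁻¹ B))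
      at-least-two (suc zero)    B≤A  = contradiction (subst (B ≤_) (+-identityʳ A) B≤A) (<⇒≱ (A<B v))
      at-least-two (suc (suc _)) _    = s≤s (s≤s z≤n)

    W : ℕ
    W = 4 * B ∸ t * A

    W+tA≡4B : W + t * A ≡ 4 * B
    W+tA≡4B = m∸n+n≡m (≤-trans tA≤2B (*-monoˡ-≤ B {2} {4} (s≤s (s≤s z≤n))))

    y x : ℕ → ℕ
    y k = ∣ T[ k ] ∣
    x k = ∣ S[ suc k ] ∣

    1≤y : ∀ k → k ≤ t → 1 ≤ y k
    1≤y k k≤t = ∈⇒1≤∣p∣ T[ k ] v (T-antitone v k≤t v∈T)

    y≤∣S∣ : ∀ k → y k ≤ ∣ S ∣
    y≤∣S∣ k = subst (y k ≤_) (cong ∣_∣ T[0]≡S) (∣T∣-antitone z≤n)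

    2y≤1+n : ∀ k → 2 * y k ≤ suc n
    2y≤1+n k = ≤-trans (*-monoʳ-≤ 2 (y≤∣S∣ k)) (bisection-bound S bisection)

    cut-bound : ∀ k → k < t → Q * cut G T[ k ] ≤ Q * D * x k + t * P * y k
    cut-bound k k<t = ≤-trans (cut-T≤ {P = P} {Q = Q} regular below-threshold k)
                              (+-monoʳ-≤ (Q * D * x k) (*-mono-≤ (*-monoˡ-≤ P k<t) (∣T-suc∣≤∣T∣ k)))

    survivor-bound : ∀ k → k < t → Q * D + Q ≤ Q * y k + t * P
    survivor-bound k k<t = ≤-trans (survivor-∣T∣ {P = P} {Q = Q} regular below-threshold v v∈T k k<t)
                                   (+-monoʳ-≤ (Q * y k) (*-monoˡ-≤ P k<t))

    per-round : ℕ
    per-round = p₂ * W * (W * D + 4 * B)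

    round-bound : ∀ k e → k < t → p₂ * D * y k ≤ q₂ * cut G T[ k ] + p₂ * D * e →
                  per-round ≤ 4 * B * Q * x k + 4 * B * (4 * B * p₂ * e)
    round-bound k e k<t expansion = begin
      p₂ * W * (W * D + 4 * B)
        ≤⟨ *-monoʳ-≤ (p₂ * W) (survivor-lower-bound {m = t} (p₂≤q₂ v) W+tA≡4B (survivor-bound k k<t)) ⟩
      p₂ * W * (4 * B * y k)              ≡⟨ regroup p₂ W (4 * B) (y k) ⟩
      4 * B * (p₂ * W * y k)              ≤⟨ *-monoʳ-≤ (4 * B) (removal-bound {m = t} W+tA≡4B (cut-bound k k<t) expansion) ⟩
      4 * B * (Q * x k + 4 * B * p₂ * e)  ≡⟨ distrib (4 * B) Q (x k) (4 * B * p₂ * e) ⟩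
      4 * B * Q * x k + 4 * B * (4 * B * p₂ * e) ∎
      where
      open ≤-Reasoning
      regroup : ∀ p w b y → p * w * (b * y) ≡ b * (p * w * y)
      regroup = solve-∀
      distrib : ∀ b q x f → b * (q * x + f) ≡ b * q * x + b * f
      distrib = solve-∀

    first-expansion : p₂ * D * y 0 ≤ q₂ * cut G T[ 0 ] + p₂ * D * 1
    first-expansion = subst (λ e → p₂ * D * y 0 ≤ q₂ * cut G T[ 0 ] + e) (sym (*-identityʳ (p₂ * D)))
      (expands-up-to-half⁺ G {c = p₂ * D} {d = q₂} expands T[ 0 ] (1≤y 0 z≤n) (2y≤1+n 0))

    -- If ∣ S ∣ = (n + 1)/2, the first round removes a vertex, so that later rounds stay below n/2.
    first-round-shrinks : 2 * ∣ S ∣ > n → 2 * y 1 ≤ n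
    first-round-shrinks 2∣S∣>n = <⇒≤ (≤-pred (begin
      2 + 2 * y 1          ≡⟨ *-suc 2 (y 1) ⟨
      2 * suc (y 1)        ≤⟨ *-monoʳ-≤ 2 (subst (suc (y 1) ≤_) (sym (∣T∣≡∣S-suc∣+∣T-suc∣ 0)) (+-monoˡ-≤ (y 1) 0<x₀)) ⟩
      2 * y 0              ≤⟨ 2y≤1+n 0 ⟩
      suc n                ∎))
      where
      open ≤-Reasoning
      2≤y₀ : 2 ≤ y 0
      2≤y₀ = half-of-three (y 0) (≤-trans (s≤s (≤-trans (s≤s (>-nonZero⁻¹ D)) (D<n v)))
                                          (subst (λ s → suc n ≤ 2 * s) (sym (cong ∣_∣ T[0]≡S)) 2∣S∣>n))
        where
        half-of-three : ∀ s → 3 ≤ 2 * s → 2 ≤ s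
        half-of-three (suc (suc s)) _ = s≤s (s≤s z≤n)
        half-of-three (suc zero) (s≤s (s≤s ()))
      W₁ : ℕ
      W₁ = 4 * B ∸ 1 * A
      W₁+A≡4B : W₁ + 1 * A ≡ 4 * B
      W₁+A≡4B = m∸n+n≡m (≤-trans (≤-reflexive (+-identityʳ A)) (≤-trans (<⇒≤ (A<B v)) (m≤n*m B 4)))
      x₀≢0 : x 0 ≢ 0
      x₀≢0 x₀≡0 = first-round-removes {W = W₁} (A<B v) 2≤y₀ W₁+A≡4B
                    (removal-bound {m = 1} {W = W₁} W₁+A≡4B cut₀ first-expansion)
        where
        cut₀ : Q * cut G T[ 0 ] ≤ Q * D * 0 + 1 * P * y 0
        cut₀ = subst (λ s → Q * cut G T[ 0 ] ≤ Q * D * s + 1 * P * y 0) x₀≡0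
          (≤-trans (cut-T≤ {P = P} {Q = Q} regular below-threshold 0)
                   (+-monoʳ-≤ (Q * D * x 0) (*-monoʳ-≤ (1 * P) (∣T-suc∣≤∣T∣ 0))))
      0<x₀ : 0 < x 0
      0<x₀ = n≢0⇒n>0 x₀≢0

    later-rounds-below-half : ∀ k → 0 < k → 2 * y k ≤ n
    later-rounds-below-half k 0<k with 2 * ∣ S ∣ ≤? n
    ... | yes 2∣S∣≤n = ≤-trans (*-monoʳ-≤ 2 (y≤∣S∣ k)) 2∣S∣≤n
    ... | no  2∣S∣≰n = ≤-trans (*-monoʳ-≤ 2 (∣T∣-antitone 0<k)) (first-round-shrinks (≰⇒> 2∣S∣≰n))

    total-bound : t * per-round ≤ 4 * B * Q * sumBelow x t + 4 * B * (4 * B * p₂)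
    total-bound = *-≤-sumBelow (4 * B * Q) x t (≤-trans (s≤s z≤n) 2≤t) first later
      where
      first : per-round ≤ 4 * B * Q * x 0 + 4 * B * (4 * B * p₂)
      first = subst (λ e → per-round ≤ 4 * B * Q * x 0 + 4 * B * e) (*-identityʳ (4 * B * p₂))
                    (round-bound 0 1 (≤-trans (s≤s z≤n) 2≤t) first-expansion)
      no-error : ∀ a b p → a + b * (b * p * 0) ≡ a
      no-error = solve-∀
      later : ∀ k → 0 < k → k < t → per-round ≤ 4 * B * Q * x k
      later k 0<k k<t = subst (per-round ≤_) (no-error (4 * B * Q * x k) (4 * B) p₂)
        (round-bound k 0 k<t (≤-trans (expands T[ k ] (1≤y k (<⇒≤ k<t)) (later-rounds-below-half k 0<k))
                                       (m≤m+n _ (p₂ * D * 0))))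

    2X<n : 2 * sumBelow x t < n
    2X<n = ≤-pred (begin
      2 + 2 * sumBelow x t              ≤⟨ +-monoˡ-≤ (2 * sumBelow x t) (*-monoʳ-≤ 2 (1≤y t ≤-refl)) ⟩
      2 * y t + 2 * sumBelow x t        ≡⟨ *-distribˡ-+ 2 (y t) (sumBelow x t) ⟨
      2 * (y t + sumBelow x t)          ≡⟨ cong (2 *_) (trans (+-comm (y t) _) (sumBelow-∣S-suc∣+∣T∣≡∣S∣ t)) ⟩
      2 * ∣ S ∣                         ≤⟨ bisection-bound S bisection ⟩
      suc n                             ∎)
      where open ≤-Reasoning

    impossible : ¬ (t * per-round ≤ 4 * B * Q * sumBelow x t + 4 * B * (4 * B * p₂))
    impossible = survival-impossible 2≤t B≤tA tA≤2B W+tA≡4B β-bound 2X<n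

  terminates : ∀ t → B ≤ t * A → t * A ≤ 2 * B → Tafter G θ S t ≡ ⊥
  terminates t B≤tA tA≤2B with nonempty? T[ t ]
  ... | no  empty        = trans (sym (T≡Tafter t)) (Empty-unique empty)
  ... | yes (v , v∈T[t]) = contradiction total-bound impossible
    where open Survivor B≤tA tA≤2B v ([]=⇒lookup v∈T[t])

  terminates-within : Fin n → ∃ λ t → t * A ≤ 2 * B × Tafter G θ S t ≡ ⊥
  terminates-within v =
    let t , B≤tA , tA≤2B = ceiling-multiple A B (>-nonZero⁻¹ A {{m*n≢0 p₁ p₂}}) (<⇒≤ (A<B v))
    in t , tA≤2B , terminates t B≤tA tA≤2B

peeling-terminates : ∀ {n D} (G : Graph n) → Regular G D → (S : Subset n) → Bisection S → (θ : ℚ) →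
  ∀ p₁ q₁ p₂ q₂ → {{NonZero p₁}} → {{NonZero q₁}} → {{NonZero p₂}} → {{NonZero q₂}} →
  p₁ * n ≤ q₁ * D →
  (∀ X → 0 < ∣ X ∣ → 2 * ∣ X ∣ ≤ n → p₂ * D * ∣ X ∣ ≤ q₂ * cut G X) →
  (∀ d → (θ ℚ.≤ᵇ ℕtoℚ d) ≡ false → 4 * q₁ * q₂ * q₂ * d < p₁ * p₂ * p₂ * D) →
  ∃ λ t → t * (p₁ * p₂) ≤ 2 * (q₁ * q₂) × Tafter G θ S t ≡ ⊥
peeling-terminates {zero}  G regular [] bisection θ p₁ q₁ p₂ q₂ _ _ _ = 0 , z≤n , refl
peeling-terminates {suc n} {D} G regular S bisection θ p₁ q₁ p₂ q₂ β-bound expands below-threshold =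
  Termination.terminates-within G regular S bisection θ p₁ q₁ p₂ q₂ β-bound expands below-threshold fzero
  where
  instance
    D≢0 : NonZero D
    D≢0 = ≢-nonZero λ D≡0 → <⇒≱ (>-nonZero⁻¹ (p₁ * suc n) {{m*n≢0 p₁ (suc n)}})
            (≤-trans β-bound (≤-reflexive (trans (cong (q₁ *_) D≡0) (*-zeroʳ q₁))))

module FromFractions {β γ : ℚ} {a₁ d₁ a₂ d₂ : ℕ} (β≈ : β ≈ suc a₁ /1+ d₁) (γ≈ : γ ≈ suc a₂ /1+ d₂)
                     {n D : ℕ} (G : Graph n) (regular : Regular G D) where

  θ : ℚ
  θ = β ℚ.* γ ℚ.* γ ℚ.* ((ℤ.+ 1) ℚ./ 4) ℚ.* ℕtoℚ D

  β-bound : β ℚ.* ℕtoℚ n ℚ.≤ ℕtoℚ D → suc a₁ * n ≤ suc d₁ * D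
  β-bound = *ℕ≤ℕ⇒cross-≤ n D β≈

  expands : ExpansionAtLeast G (γ ℚ.* ℕtoℚ D) →
            ∀ X → 0 < ∣ X ∣ → 2 * ∣ X ∣ ≤ n → suc a₂ * D * ∣ X ∣ ≤ suc d₂ * cut G X
  expands expansion X 0<∣X∣ 2∣X∣≤n = subst (λ q → suc a₂ * D * ∣ X ∣ ≤ q * cut G X) (cong suc (*-identityʳ d₂))
    (*ℕ≤ℕ⇒cross-≤ ∣ X ∣ (cut G X) (*-≈ γ≈ (ℕtoℚ≈ D)) (expansion X 0<∣X∣ 2∣X∣≤n))

  below-threshold : ∀ d → (θ ℚ.≤ᵇ ℕtoℚ d) ≡ false → 4 * suc d₁ * suc d₂ * suc d₂ * d < suc a₁ * suc a₂ * suc a₂ * D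
  below-threshold d θ≰ᵇd = subst₂ _<_ (denominator (suc d₁) (suc d₂) d) (numerator (suc a₁) (suc a₂) D)
    (≤ᵇ≡false⇒cross-< d (*-≈ (*-≈ (*-≈ (*-≈ β≈ γ≈) γ≈) 1/4≈) (ℕtoℚ≈ D)) θ≰ᵇd)
    where
    denominator : ∀ q₁ q₂ d → q₁ * q₂ * q₂ * 4 * 1 * d ≡ 4 * q₁ * q₂ * q₂ * d
    denominator = solve-∀
    numerator : ∀ p₁ p₂ D → p₁ * p₂ * p₂ * 1 * D ≡ p₁ * p₂ * p₂ * D
    numerator = solve-∀

  rate-bound : ∀ t → t * (suc a₁ * suc a₂) ≤ 2 * (suc d₁ * suc d₂) → ℕtoℚ t ℚ.* (β ℚ.* γ) ℚ.≤ ℕtoℚ 2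
  rate-bound t = cross-≤⇒ℕ*≤ℕ t 2 (*-≈ β≈ γ≈)

  theorem : β ℚ.* ℕtoℚ n ℚ.≤ ℕtoℚ D → ExpansionAtLeast G (γ ℚ.* ℕtoℚ D) → (S : Subset n) → Bisection S →
            ∃ λ t → (ℕtoℚ t ℚ.* (β ℚ.* γ) ℚ.≤ ℕtoℚ 2) × (Tafter G θ S t ≡ ⊥)
  theorem βn≤D expansion S bisection =
    let t , tA≤2B , T≡⊥ = peeling-terminates G regular S bisection θ (suc a₁) (suc d₁) (suc a₂) (suc d₂)
                              (β-bound βn≤D) (expands expansion) below-threshold
    in t , rate-bound t tA≤2B , T≡⊥

lemma1 : (β γ : ℚ) → ℚ.Positive β → ℚ.Positive γ →
         (n D : ℕ) (G : Graph n) → Regular G D →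
         β ℚ.* ℕtoℚ n ℚ.≤ ℕtoℚ D →
         ExpansionAtLeast G (γ ℚ.* ℕtoℚ D) →
         (S : Subset n) → Bisection S →
         ∃ λ (t : ℕ) →
           (ℕtoℚ t ℚ.* (β ℚ.* γ) ℚ.≤ ℕtoℚ 2)
           × (Tafter G (β ℚ.* γ ℚ.* γ ℚ.* ((ℤ.+ 1) ℚ./ 4) ℚ.* ℕtoℚ D) S t ≡ ⊥)
lemma1 β γ β>0 γ>0 n D G regular =
  FromFractions.theorem (proj₂ (proj₂ (positive⇒≈ β β>0))) (proj₂ (proj₂ (positive⇒≈ γ γ>0))) G regular
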